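{- Let $\bm\lambda=(R_1,\dots,R_n)$ be a horizontal-strip and $i,j,k$ distinct indices. (1) If $R_i\nleftrightarrow R_j$, $R_j\nleftrightarrow R_k$, $R_i\leftrightarrow R_k$, and the integers $l(R_j)-l(R_i)$ and $l(R_k)-l(R_j)$ have the same sign, then $M_{i,k}=0$. (2) If $R_i\nleftrightarrow R_j$, $R_j\nleftrightarrow R_k$, $R_i\leftrightarrow R_k$, and the integers $l(R_j)-l(R_i)$ and $l(R_k)-l(R_j)$ have opposite signs, then $R_i\prec R_k$ or $R_k\prec R_i$. (3) If $R_i\leftrightarrow R_j$, $R_i\leftrightarrow R_k$, and $R_j\nleftrightarrow R_k$, then $R_j\prec R_i$ if and only if $R_k\prec R_i$.
   Context: A row is $R=a/b=\{(1,j):b+1\le j\le a\}$ ($a\ge b\ge0$ integers); $l(R)=b$, $r(R)=a-1$, $|R|$ its number of cells, $R^+=(a+1)/(b+1)$. For rows $R,R'$: $M(R,R')=|R\cap R'|$ if $l(R)\le l(R')$, else $|R\cap R'^+|$. Rows commute, $R\leftrightarrow R'$, if $M(R,R')=M(R',R)$; otherwise $R\nleftrightarrow R'$. A horizontal-strip is a sequence of rows $(R_1,\dots,R_n)$; for $i\ne j$, $M_{i,j}=M(R_{\min(i,j)},R_{\max(i,j)})$, and $R_i\prec R_j$ means $M_{i,j}=|R_i|$. -}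

module Defs where

open import Data.Nat using (ℕ; suc; _≤_; _∸_; _⊓_; _⊔_; _≤ᵇ_)
open import Data.Bool using (if_then_else_)
open import Data.Fin using (Fin; toℕ)
open import Data.Integer using (ℤ; +_; _-_; _<_; _>_; 0ℤ)
open import Data.Product using (_×_)
open import Data.Sum using (_⊎_)
open import Relation.Binary.PropositionalEquality using (_≡_; _≢_)
open import Relation.Nullary using (¬_)

-- A row a/b = {(1,j) : b+1 ≤ j ≤ a}, with a ≥ b ≥ 0.
record Row : Set where
  constructor _/_[_]
  field
    a : ℕ
    b : ℕ
    b≤a : b ≤ a
open Row public

l : Row → ℕ
l R = b R

r : Row → ℕ
r R = a R ∸ 1

size : Row → ℕ
size R = a R ∸ b R

_⁺ : Row → Row
(x / y [ p ]) ⁺ = suc x / suc y [ Data.Nat.s≤s p ]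

-- |R ∩ R'|: the cells of a/b are the columns b+1..a, so the intersection of
-- a/b and a'/b' is the columns max(b,b')+1 .. min(a,a'); its cardinality is
-- min(a,a') ∸ max(b,b') (0 when empty).
∣_∩_∣ : Row → Row → ℕ
∣ R ∩ R' ∣ = (a R ⊓ a R') ∸ (b R ⊔ b R')

M : Row → Row → ℕ
M R R' = if l R ≤ᵇ l R' then ∣ R ∩ R' ∣ else ∣ R ∩ (R' ⁺) ∣

_↔_ : Row → Row → Set
R ↔ R' = M R R' ≡ M R' R

_↮_ : Row → Row → Set
R ↮ R' = ¬ (R ↔ R')

HStrip : ℕ → Set
HStrip n = Fin n → Row

Mij : ∀ {n} → HStrip n → Fin n → Fin n → ℕ
Mij λs i j = if toℕ i ≤ᵇ toℕ j then M (λs i) (λs j) else M (λs j) (λs i)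

Prec : ∀ {n} → HStrip n → Fin n → Fin n → Set
Prec λs i j = Mij λs i j ≡ size (λs i)

SameSign : ℤ → ℤ → Set
SameSign x y = (x < 0ℤ × y < 0ℤ) ⊎ (x ≡ 0ℤ × y ≡ 0ℤ) ⊎ (x > 0ℤ × y > 0ℤ)

OppositeSign : ℤ → ℤ → Set
OppositeSign x y = (x < 0ℤ × y > 0ℤ) ⊎ (x > 0ℤ × y < 0ℤ)

Δl : Row → Row → ℤ
Δl R R' = + l R' - + l R

-- Two rows with
-- l R < l T commute unless they interleave (l T ≤ a R < a T), so commuting rows
-- are separated (a R < l T) or nested; and for commuting rows R ≺ T says that
-- the cells of R lie among those of T. In (1) the two interleavings push the
-- right ends of R_i, R_j, R_k up, so R_i and R_k cannot be nested and must be
-- separated; in (2) the middle row R_j makes R_i and R_k overlap, hence nest;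
-- in (3) the interleaving of R_j and R_k transfers inclusion in R_i from one to
-- the other.
module Submission where

open import Defs
open import Data.Nat using (ℕ; suc; _≤_; _<_; _∸_; _⊓_; _≤ᵇ_; _≤?_; _<?_)
open import Data.Nat.Properties
open import Data.Bool using (true; false)
open import Data.Unit using (tt)
open import Data.Fin using (Fin; toℕ)
open import Data.Integer as ℤ using (+_; +≤+)
import Data.Integer.Properties as ℤP
open import Data.Product using (_×_; _,_; proj₂)
open import Data.Sum using (_⊎_; inj₁; inj₂)
import Data.Sum as Sum
open import Data.Empty using (⊥-elim)
open import Relation.Nullary using (yes; no)
open import Function.Bundles using (_⇔_; mk⇔; module Equivalence)
import Function.Properties.Equivalence as ⇔
open import Relation.Binary using (tri<; tri≈; tri>)
open import Relation.Binary.PropositionalEquality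
  using (_≡_; _≢_; refl; sym; trans; cong; cong₂; subst; module ≡-Reasoning)

⊓∸≡∸⇒≤ : ∀ {m n c} → c < m → (m ⊓ n) ∸ c ≡ m ∸ c → m ≤ n
⊓∸≡∸⇒≤ {m} {n} {c} c<m eq = subst (_≤ n) m⊓n≡m (m⊓n≤n m n)
  where
  c<m⊓n : c < m ⊓ n
  c<m⊓n = m∸n≢0⇒n<m (λ e → <⇒≱ c<m (m∸n≡0⇒m≤n (trans (sym eq) e)))

  m⊓n≡m : m ⊓ n ≡ m
  m⊓n≡m = ∸-cancelʳ-≡ (<⇒≤ c<m⊓n) (<⇒≤ c<m) eq

M-≤ : ∀ R T → l R ≤ l T → M R T ≡ (a R ⊓ a T) ∸ l T
M-≤ R T lR≤lT with l R ≤ᵇ l T | ≤⇒≤ᵇ lR≤lT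
... | true | _ = cong (a R ⊓ a T ∸_) (m≤n⇒m⊔n≡n lR≤lT)

M-> : ∀ R T → l T < l R → M R T ≡ (a R ⊓ suc (a T)) ∸ l R
M-> R T lT<lR with l R ≤ᵇ l T | ≤ᵇ⇒≤ (l R) (l T)
... | true  | lR≤lT = ⊥-elim (<⇒≱ lT<lR (lR≤lT tt))
... | false | _     = cong (a R ⊓ suc (a T) ∸_) (m≥n⇒m⊔n≡m lT<lR)

↮-sym : ∀ R T → R ↮ T → T ↮ R
↮-sym R T R↮T T↔R = R↮T (sym T↔R)

l≡⇒↔ : ∀ R T → l R ≡ l T → R ↔ T
l≡⇒↔ R T lR≡lT = begin
  M R T              ≡⟨ M-≤ R T (≤-reflexive lR≡lT) ⟩
  (a R ⊓ a T) ∸ l T  ≡⟨ cong₂ _∸_ (⊓-comm (a R) (a T)) (sym lR≡lT) ⟩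
  (a T ⊓ a R) ∸ l R  ≡⟨ M-≤ T R (≤-reflexive (sym lR≡lT)) ⟨
  M T R              ∎
  where open ≡-Reasoning

-- Inclusion of cells, read with the endpoints (so only meaningful for nonempty S).
_⊆_ : Row → Row → Set
S ⊆ R = l R ≤ l S × a S ≤ a R

_≺_ : Row → Row → Set
S ≺ R = M S R ≡ size S

⊆⇒≺ : ∀ S R → S ⊆ R → S ≺ R
⊆⇒≺ S R (lR≤lS , aS≤aR) with l S ≤? l R
... | yes lS≤lR = trans (M-≤ S R lS≤lR)
    (cong₂ _∸_ (m≤n⇒m⊓n≡m aS≤aR) (≤-antisym lR≤lS lS≤lR))
... | no lS≰lR = trans (M-> S R (≰⇒> lS≰lR))
    (cong (_∸ l S) (m≤n⇒m⊓n≡m (m≤n⇒m≤1+n aS≤aR)))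

separated⇒M≡0 : ∀ R T → l R ≤ l T → a R ≤ l T → M R T ≡ 0
separated⇒M≡0 R T lR≤lT aR≤lT =
  trans (M-≤ R T lR≤lT) (m≤n⇒m∸n≡0 (≤-trans (m⊓n≤m (a R) (a T)) aR≤lT))

separated⇒↔ : ∀ R T → l R < l T → a R < l T → R ↔ T
separated⇒↔ R T lR<lT aR<lT = trans (separated⇒M≡0 R T (<⇒≤ lR<lT) (<⇒≤ aR<lT))
  (sym (trans (M-> T R lR<lT) (m≤n⇒m∸n≡0 (≤-trans (m⊓n≤n (a T) (suc (a R))) aR<lT))))

⊇⇒↔ : ∀ R T → l R < l T → T ⊆ R → R ↔ T
⊇⇒↔ R T lR<lT T⊆R = trans (M-≤ R T (<⇒≤ lR<lT))
  (trans (cong (_∸ l T) (m≥n⇒m⊓n≡n (proj₂ T⊆R))) (sym (⊆⇒≺ T R T⊆R)))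

interleaved⇒M-suc : ∀ R T → l R < l T → l T ≤ a R → a R < a T → M T R ≡ suc (M R T)
interleaved⇒M-suc R T lR<lT lT≤aR aR<aT = begin
  M T R                     ≡⟨ M-> T R lR<lT ⟩
  (a T ⊓ suc (a R)) ∸ l T   ≡⟨ cong (_∸ l T) (m≥n⇒m⊓n≡n aR<aT) ⟩
  suc (a R) ∸ l T           ≡⟨ +-∸-assoc 1 lT≤aR ⟩
  suc (a R ∸ l T)           ≡⟨ cong (λ x → suc (x ∸ l T)) (m≤n⇒m⊓n≡m (<⇒≤ aR<aT)) ⟨
  suc ((a R ⊓ a T) ∸ l T)   ≡⟨ cong suc (M-≤ R T (<⇒≤ lR<lT)) ⟨
  suc (M R T)               ∎
  where open ≡-Reasoning

↔⇒separated⊎⊇ : ∀ R T → l R < l T → R ↔ T → a R < l T ⊎ T ⊆ R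
↔⇒separated⊎⊇ R T lR<lT R↔T with a R <? l T | a T ≤? a R
... | yes aR<lT | _        = inj₁ aR<lT
... | no  _     | yes aT≤aR = inj₂ (<⇒≤ lR<lT , aT≤aR)
... | no  aR≮lT | no aT≰aR =
  ⊥-elim (1+n≢n (trans (sym (interleaved⇒M-suc R T lR<lT (≮⇒≥ aR≮lT) (≰⇒> aT≰aR))) (sym R↔T)))

↮⇒interleaved : ∀ R T → l R < l T → R ↮ T → l T ≤ a R × a R < a T
↮⇒interleaved R T lR<lT R↮T with a R <? l T | a T ≤? a R
... | yes aR<lT | _        = ⊥-elim (R↮T (separated⇒↔ R T lR<lT aR<lT))
... | no  _     | yes aT≤aR = ⊥-elim (R↮T (⊇⇒↔ R T lR<lT (<⇒≤ lR<lT , aT≤aR)))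
... | no  aR≮lT | no aT≰aR = ≮⇒≥ aR≮lT , ≰⇒> aT≰aR

≺⇒⊆ : ∀ R S → R ↔ S → l S < a S → S ≺ R → S ⊆ R
≺⇒⊆ R S R↔S lS<aS S≺R with <-cmp (l S) (l R)
... | tri< lS<lR _ _ = ⊥-elim (<-irrefl refl (begin-strict
  a S ∸ l S          ≡⟨ S≺R ⟨
  M S R              ≡⟨ M-≤ S R (<⇒≤ lS<lR) ⟩
  (a S ⊓ a R) ∸ l R  ≤⟨ ∸-monoˡ-≤ (l R) (m⊓n≤m (a S) (a R)) ⟩
  a S ∸ l R          ≤⟨ ∸-monoʳ-≤ (a S) lS<lR ⟩
  a S ∸ suc (l S)    <⟨ ∸-monoʳ-< (n<1+n (l S)) lS<aS ⟩
  a S ∸ l S          ∎))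
  where open ≤-Reasoning
... | tri≈ _ lS≡lR _ = ≤-reflexive (sym lS≡lR) ,
  ⊓∸≡∸⇒≤ lS<aS (trans (cong (a S ⊓ a R ∸_) lS≡lR) (trans (sym (M-≤ S R (≤-reflexive lS≡lR))) S≺R))
... | tri> _ _ lR<lS with ↔⇒separated⊎⊇ R S lR<lS R↔S
...   | inj₂ S⊆R = S⊆R
...   | inj₁ aR<lS = ⊥-elim (<⇒≱ lS<aS (≤-trans aS≤1+aR aR<lS))
  where
  aS≤1+aR : a S ≤ suc (a R)
  aS≤1+aR = ⊓∸≡∸⇒≤ lS<aS (trans (sym (M-> S R lR<lS)) S≺R)

↔⇒≺⇔⊆ : ∀ R S → R ↔ S → l S < a S → S ≺ R ⇔ S ⊆ R
↔⇒≺⇔⊆ R S R↔S lS<aS = mk⇔ (≺⇒⊆ R S R↔S lS<aS) (⊆⇒≺ S R)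

↔⇒overlapping⇒nested : ∀ R T → R ↔ T → l R < a T → l T < a R → R ⊆ T ⊎ T ⊆ R
↔⇒overlapping⇒nested R T R↔T lR<aT lT<aR with <-cmp (l R) (l T)
... | tri< lR<lT _ _ = Sum.map₁ (λ aR<lT → ⊥-elim (<-asym aR<lT lT<aR))
  (↔⇒separated⊎⊇ R T lR<lT R↔T)
... | tri> _ _ lT<lR = Sum.swap (Sum.map₁ (λ aT<lR → ⊥-elim (<-asym aT<lR lR<aT))
  (↔⇒separated⊎⊇ T R lT<lR (sym R↔T)))
... | tri≈ _ lR≡lT _ with a R ≤? a T
...   | yes aR≤aT = inj₁ (≤-reflexive (sym lR≡lT) , aR≤aT)
...   | no  aR≰aT = inj₂ (≤-reflexive lR≡lT , <⇒≤ (≰⇒> aR≰aT))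

0<n-m⇒m<n : ∀ {m n} → ℤ.0ℤ ℤ.< + n ℤ.- + m → m < n
0<n-m⇒m<n 0<n-m = ≰⇒> (λ n≤m → ℤP.<⇒≱ 0<n-m (ℤP.i≤j⇒i-j≤0 (+≤+ n≤m)))

n-m<0⇒n<m : ∀ {m n} → + n ℤ.- + m ℤ.< ℤ.0ℤ → n < m
n-m<0⇒n<m n-m<0 = ≰⇒> (λ m≤n → ℤP.<⇒≱ n-m<0 (ℤP.i≤j⇒0≤j-i (+≤+ m≤n)))

n-m≡0⇒n≡m : ∀ {m n} → + n ℤ.- + m ≡ ℤ.0ℤ → n ≡ m
n-m≡0⇒n≡m {m} {n} eq = ℤP.+-injective (ℤP.i-j≡0⇒i≡j (+ n) (+ m) eq)

sameSign⇒monotone : ∀ R S T → SameSign (Δl R S) (Δl S T) →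
  (l R < l S × l S < l T) ⊎ l R ≡ l S ⊎ (l S < l R × l T < l S)
sameSign⇒monotone R S T (inj₁ (ΔRS<0 , ΔST<0)) =
  inj₂ (inj₂ (n-m<0⇒n<m ΔRS<0 , n-m<0⇒n<m ΔST<0))
sameSign⇒monotone R S T (inj₂ (inj₁ (ΔRS≡0 , _))) = inj₂ (inj₁ (sym (n-m≡0⇒n≡m ΔRS≡0)))
sameSign⇒monotone R S T (inj₂ (inj₂ (ΔRS>0 , ΔST>0))) =
  inj₁ (0<n-m⇒m<n ΔRS>0 , 0<n-m⇒m<n ΔST>0)

oppositeSign⇒turning : ∀ R S T → OppositeSign (Δl R S) (Δl S T) →
  (l S < l R × l S < l T) ⊎ (l R < l S × l T < l S)
oppositeSign⇒turning R S T (inj₁ (ΔRS<0 , ΔST>0)) = inj₁ (n-m<0⇒n<m ΔRS<0 , 0<n-m⇒m<n ΔST>0)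
oppositeSign⇒turning R S T (inj₂ (ΔRS>0 , ΔST<0)) = inj₂ (0<n-m⇒m<n ΔRS>0 , n-m<0⇒n<m ΔST<0)

↮-increasing⇒M≡0 : ∀ R S T → R ↮ S → S ↮ T → R ↔ T →
  l R < l S → l S < l T → M R T ≡ 0
↮-increasing⇒M≡0 R S T R↮S S↮T R↔T lR<lS lS<lT
  with ↮⇒interleaved R S lR<lS R↮S | ↮⇒interleaved S T lS<lT S↮T
     | ↔⇒separated⊎⊇ R T (<-trans lR<lS lS<lT) R↔T
... | _ | _ | inj₁ aR<lT = separated⇒M≡0 R T (<⇒≤ (<-trans lR<lS lS<lT)) (<⇒≤ aR<lT)
... | _ , aR<aS | _ , aS<aT | inj₂ (_ , aT≤aR) =
  ⊥-elim (<⇒≱ (<-trans aR<aS aS<aT) aT≤aR)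

↮-sameSign⇒M≡0 : ∀ R S T → R ↮ S → S ↮ T → R ↔ T →
  SameSign (Δl R S) (Δl S T) → M R T ≡ 0
↮-sameSign⇒M≡0 R S T R↮S S↮T R↔T ss with sameSign⇒monotone R S T ss
... | inj₁ (lR<lS , lS<lT) = ↮-increasing⇒M≡0 R S T R↮S S↮T R↔T lR<lS lS<lT
... | inj₂ (inj₁ lR≡lS) = ⊥-elim (R↮S (l≡⇒↔ R S lR≡lS))
... | inj₂ (inj₂ (lS<lR , lT<lS)) =
  trans R↔T (↮-increasing⇒M≡0 T S R (↮-sym S T S↮T) (↮-sym R S R↮S) (sym R↔T) lT<lS lS<lR)

↮-oppositeSign⇒nested : ∀ R S T → R ↮ S → S ↮ T → R ↔ T →
  OppositeSign (Δl R S) (Δl S T) → R ⊆ T ⊎ T ⊆ R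
↮-oppositeSign⇒nested R S T R↮S S↮T R↔T os with oppositeSign⇒turning R S T os
... | inj₁ (lS<lR , lS<lT)
  with ↮⇒interleaved S R lS<lR (↮-sym R S R↮S) | ↮⇒interleaved S T lS<lT S↮T
...   | lR≤aS , aS<aR | lT≤aS , aS<aT =
  ↔⇒overlapping⇒nested R T R↔T (≤-<-trans lR≤aS aS<aT) (≤-<-trans lT≤aS aS<aR)
↮-oppositeSign⇒nested R S T R↮S S↮T R↔T os | inj₂ (lR<lS , lT<lS)
  with ↮⇒interleaved R S lR<lS R↮S | ↮⇒interleaved T S lT<lS (↮-sym S T S↮T)
...   | lS≤aR , _ | lS≤aT , _ =
  ↔⇒overlapping⇒nested R T R↔T (<-≤-trans lR<lS lS≤aT) (<-≤-trans lT<lS lS≤aR)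

interleaved⇒⊆⇔⊆ : ∀ R S T → R ↔ S → R ↔ T →
  l S < l T → l T ≤ a S → a S < a T → S ⊆ R ⇔ T ⊆ R
interleaved⇒⊆⇔⊆ R S T R↔S R↔T lS<lT lT≤aS aS<aT = mk⇔ S⊆R⇒T⊆R T⊆R⇒S⊆R
  where
  S⊆R⇒T⊆R : S ⊆ R → T ⊆ R
  S⊆R⇒T⊆R (lR≤lS , aS≤aR) with ↔⇒separated⊎⊇ R T (≤-<-trans lR≤lS lS<lT) R↔T
  ... | inj₁ aR<lT = ⊥-elim (<⇒≱ aR<lT (≤-trans lT≤aS aS≤aR))
  ... | inj₂ T⊆R = T⊆R

  T⊆R⇒S⊆R : T ⊆ R → S ⊆ R
  T⊆R⇒S⊆R (lR≤lT , aT≤aR) with l R ≤? l S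
  ... | yes lR≤lS = lR≤lS , <⇒≤ (<-≤-trans aS<aT aT≤aR)
  ... | no lR≰lS with ↔⇒separated⊎⊇ S R (≰⇒> lR≰lS) (sym R↔S)
  ...   | inj₁ aS<lR = ⊥-elim (<⇒≱ aS<lR (≤-trans lR≤lT lT≤aS))
  ...   | inj₂ (_ , aR≤aS) = ⊥-elim (<⇒≱ (<-≤-trans aS<aT aT≤aR) aR≤aS)

interleaved⇒≺⇔≺ : ∀ R S T → R ↔ S → R ↔ T →
  l S < l T → l T ≤ a S → a S < a T → S ≺ R ⇔ T ≺ R
interleaved⇒≺⇔≺ R S T R↔S R↔T lS<lT lT≤aS aS<aT =
  ⇔.trans (↔⇒≺⇔⊆ R S R↔S (<-≤-trans lS<lT lT≤aS))
    (⇔.trans (interleaved⇒⊆⇔⊆ R S T R↔S R↔T lS<lT lT≤aS aS<aT)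
             (⇔.sym (↔⇒≺⇔⊆ R T R↔T (≤-<-trans lT≤aS aS<aT))))

↮⇒≺⇔≺ : ∀ R S T → R ↔ S → R ↔ T → S ↮ T → S ≺ R ⇔ T ≺ R
↮⇒≺⇔≺ R S T R↔S R↔T S↮T with <-cmp (l S) (l T)
... | tri≈ _ lS≡lT _ = ⊥-elim (S↮T (l≡⇒↔ S T lS≡lT))
... | tri< lS<lT _ _ with ↮⇒interleaved S T lS<lT S↮T
...   | lT≤aS , aS<aT = interleaved⇒≺⇔≺ R S T R↔S R↔T lS<lT lT≤aS aS<aT
↮⇒≺⇔≺ R S T R↔S R↔T S↮T | tri> _ _ lT<lS with ↮⇒interleaved T S lT<lS (↮-sym S T S↮T)
...   | lS≤aT , aT<aS = ⇔.sym (interleaved⇒≺⇔≺ R T S R↔T R↔S lT<lS lS≤aT aT<aS)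

Mij-↔ : ∀ {n} (λs : HStrip n) i k → λs i ↔ λs k → Mij λs i k ≡ M (λs i) (λs k)
Mij-↔ λs i k Ri↔Rk with toℕ i ≤ᵇ toℕ k
... | true  = refl
... | false = sym Ri↔Rk

Prec⇔≺ : ∀ {n} (λs : HStrip n) i k → λs i ↔ λs k → Prec λs i k ⇔ λs i ≺ λs k
Prec⇔≺ λs i k Ri↔Rk = mk⇔ (trans (sym (Mij-↔ λs i k Ri↔Rk))) (trans (Mij-↔ λs i k Ri↔Rk))

proposition5p6 : ∀ {n : ℕ} (λs : HStrip n) (i j k : Fin n) →
    i ≢ j → j ≢ k → i ≢ k →
    ((λs i ↮ λs j) → (λs j ↮ λs k) → (λs i ↔ λs k) →
      SameSign (Δl (λs i) (λs j)) (Δl (λs j) (λs k)) → Mij λs i k ≡ 0)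
    × ((λs i ↮ λs j) → (λs j ↮ λs k) → (λs i ↔ λs k) →
      OppositeSign (Δl (λs i) (λs j)) (Δl (λs j) (λs k)) →
      Prec λs i k ⊎ Prec λs k i)
    × ((λs i ↔ λs j) → (λs i ↔ λs k) → (λs j ↮ λs k) →
      (Prec λs j i ⇔ Prec λs k i))
proposition5p6 λs i j k _ _ _ =
    (λ Rᵢ↮Rⱼ Rⱼ↮Rₖ Rᵢ↔Rₖ ss → trans (Mij-↔ λs i k Rᵢ↔Rₖ)
      (↮-sameSign⇒M≡0 (λs i) (λs j) (λs k) Rᵢ↮Rⱼ Rⱼ↮Rₖ Rᵢ↔Rₖ ss))
  , (λ Rᵢ↮Rⱼ Rⱼ↮Rₖ Rᵢ↔Rₖ os → Sum.map
      (λ Rᵢ⊆Rₖ → Equivalence.from (Prec⇔≺ λs i k Rᵢ↔Rₖ) (⊆⇒≺ (λs i) (λs k) Rᵢ⊆Rₖ))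
      (λ Rₖ⊆Rᵢ → Equivalence.from (Prec⇔≺ λs k i (sym Rᵢ↔Rₖ)) (⊆⇒≺ (λs k) (λs i) Rₖ⊆Rᵢ))
      (↮-oppositeSign⇒nested (λs i) (λs j) (λs k) Rᵢ↮Rⱼ Rⱼ↮Rₖ Rᵢ↔Rₖ os))
  , (λ Rᵢ↔Rⱼ Rᵢ↔Rₖ Rⱼ↮Rₖ → ⇔.trans (Prec⇔≺ λs j i (sym Rᵢ↔Rⱼ))
      (⇔.trans (↮⇒≺⇔≺ (λs i) (λs j) (λs k) Rᵢ↔Rⱼ Rᵢ↔Rₖ Rⱼ↮Rₖ)
               (⇔.sym (Prec⇔≺ λs k i (sym Rᵢ↔Rₖ)))))
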